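{- Let $\mathcal{R},\mathcal{S}$ be TRSs over $\mathcal{F}$ such that $\mathcal{R}\cup\mathcal{S}$ is non-duplicating and $\mathcal{R}$ is non-collapsing, and let $L\subseteq\mathcal{T}(\mathcal{F})$ be a set of ground terms. If $\mathcal{R}/\mathcal{S}$ is match-raise-RT-bounded for $L$, then $\to_{\mathcal{R}/\mathcal{S}}$ is terminating on $L$ and $\mathrm{cp}(n,\to_{\mathcal{R}/\mathcal{S}},L)=O(n)$.
   Context: $\to_{\mathcal{R}/\mathcal{S}}=\to_{\mathcal{S}}^*\cdot\to_{\mathcal{R}}\cdot\to_{\mathcal{S}}^*$; $\mathrm{cp}(n,\to,L)=\sup\{\mathrm{dl}(t,\to)\mid t\in L,|t|\le n\}$, $\mathrm{dl}(t,\to)=\sup\{m\mid\exists u,\ t\to^mu\}$. Non-duplicating: no variable occurs more often in $r$ than in $l$ for a rule $l\to r$; collapsing: some right-hand side is a variable. For $N\subseteq\mathbb{N}$, $\mathcal{F}_N$ has symbols $f_c$ ($f\in\mathcal{F},c\in N$); $\mathrm{lift}_c(f)=f_c$, $\mathrm{base}(f_c)=f$, $\mathrm{height}(f_c)=c$, extended to terms, sets, TRSs. $\mathrm{FPos}(t)$: positions of function symbols; $\|t\|$: number of function symbol occurrences. $\mathrm{match}(\mathcal{R})$: rules $l'\to\mathrm{lift}_c(r)$ with $l\to r\in\mathcal{R}$, $\mathrm{base}(l')=l$, $c=1+\min\{\mathrm{height}(l'(p))\mid p\in\mathrm{FPos}(l)\}$. $\mathrm{MATCHRT}^c(\mathcal{S})$: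 rules $l'\to\mathrm{lift}_d(r)$ with $\mathrm{base}(l')\to r\in\mathcal{S}$, where $d=\min\{c,\mathrm{height}(l'(\epsilon))\}$ if $\|\mathrm{base}(l')\|\ge\|r\|$ and $\mathrm{lift}_{\mathrm{height}(l'(\epsilon))}(\mathrm{base}(l'))=l'$, else $d=\min(\{c\}\cup\{1+\mathrm{height}(l'(p))\mid p\in\mathrm{FPos}(l')\})$. $\mathrm{Raise}(\mathcal{F})$: rules $f_c(x_1,\dots,x_n)\to f_{c+1}(x_1,\dots,x_n)$; $s\uparrow t$: least common $\to^*_{\mathrm{Raise}(\mathcal{F})}$-reduct of $s,t$ (least w.r.t. sum of lengths of joining sequences), extended to finite nonempty sets. For a TRS $\mathcal{T}$ over $\mathcal{F}_{\mathbb{N}}$: $s\rightsquigarrow_{\mathcal{T}}t$ iff there are $l\to r\in\mathcal{T}$, a position $p$, context $C$, terms $s_1,\dots,s_n$ with $l=C[x_1,\dots,x_n]$ (all variable occurrences displayed), $s|_p=C[s_1,\dots,s_n]$, $\mathrm{base}(s_i)=\mathrm{base}(s_j)$ whenever $x_i=x_j$, and $t=s[r\sigma]_p$ with $\sigma(x)=\uparrow\{s_i\mid x_i=x\}$ for $x\in\{x_1,\dots,x_n\}$, $\sigma(x)=x$ otherwise. Define $\rightsquigarrow_{\mathrm{matchRT}(\mathcal{R}/\mathcal{S},c)}=\rightsquigarrow^*_{\mathrm{MATCHRT}^c(\mathcal{S})}\cdot\rightsquigarrow_{\mathrm{match}(\mathcal{R})}\cdot\rightsquigarrow^*_{\mathrm{MATCHRT}^c(\mathcal{S})}$.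 $\mathrm{Succ}_{\to}(K)=\{t\text{ ground}\mid s\to^*t,\ s\in K\}$. $\mathcal{R}/\mathcal{S}$ is match-raise-RT-bounded for $L$ if there is $c\in\mathbb{N}$ such that all function symbols in terms of $\mathrm{Succ}_{\rightsquigarrow_{\mathrm{matchRT}(\mathcal{R}/\mathcal{S},c)}}(\mathrm{lift}_0(L))$ have height at most $c$. -}

module Defs where

open import Data.Nat using (ℕ; zero; suc; _+_; _*_; _≤_; _⊓_; _≟_)
open import Data.Fin using (Fin; toℕ)
open import Data.Vec using (Vec; []; _∷_; lookup; tabulate; _[_]≔_)
open import Data.List using (List; []; _∷_; _++_; foldr) renaming (map to lmap)
open import Data.Nat.ListAction using (sum)
open import Data.List.Membership.Propositional using (_∈_)
open import Data.List.Relation.Unary.All using (All)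
open import Data.List.Relation.Binary.Pointwise using (Pointwise)
open import Data.Product using (Σ; ∃; _×_; _,_; proj₁; proj₂)
open import Data.Sum using (_⊎_)
open import Data.Bool using (if_then_else_)
open import Relation.Nullary using (¬_; does)
open import Relation.Binary.PropositionalEquality using (_≡_; _≢_)
open import Relation.Binary.Construct.Closure.ReflexiveTransitive using (Star)
open import Induction.WellFounded using (Acc)
open import Function using (flip)

data Term (F : Set) (ar : F → ℕ) : Set where
  var : ℕ → Term F ar
  fun : (f : F) → Vec (Term F ar) (ar f) → Term F ar

private variable
  A : Set
  F : Set
  ar : F → ℕ
  n : ℕ

Rule : (F : Set) → (F → ℕ) → Set
Rule F ar = Term F ar × Term F ar

-- a (possibly infinite) set of rules
RuleSet : (F : Set) → (F → ℕ) → Set₁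
RuleSet F ar = Rule F ar → Set

⟦_⟧ : List (Rule F ar) → RuleSet F ar
⟦ R ⟧ ρ = ρ ∈ R

mutual
  _⟨_⟩ : Term F ar → (ℕ → Term F ar) → Term F ar
  var x ⟨ σ ⟩ = σ x
  fun f ts ⟨ σ ⟩ = fun f (ts ⟨ σ ⟩*)

  _⟨_⟩* : Vec (Term F ar) n → (ℕ → Term F ar) → Vec (Term F ar) n
  [] ⟨ σ ⟩* = []
  (t ∷ ts) ⟨ σ ⟩* = (t ⟨ σ ⟩) ∷ (ts ⟨ σ ⟩*)

mutual
  size : Term F ar → ℕ
  size (var x) = 1
  size (fun f ts) = suc (sizes ts)

  sizes : Vec (Term F ar) n → ℕ
  sizes [] = 0
  sizes (t ∷ ts) = size t + sizes ts

mutual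
  fsize : Term F ar → ℕ
  fsize (var x) = 0
  fsize (fun f ts) = suc (fsizes ts)

  fsizes : Vec (Term F ar) n → ℕ
  fsizes [] = 0
  fsizes (t ∷ ts) = fsize t + fsizes ts

mutual
  vars : Term F ar → List ℕ
  vars (var x) = x ∷ []
  vars (fun f ts) = varss ts

  varss : Vec (Term F ar) n → List ℕ
  varss [] = []
  varss (t ∷ ts) = vars t ++ varss ts

mutual
  varCount : ℕ → Term F ar → ℕ
  varCount x (var y) = if does (x ≟ y) then 1 else 0
  varCount x (fun f ts) = varCounts x ts

  varCounts : ℕ → Vec (Term F ar) n → ℕ
  varCounts x [] = 0
  varCounts x (t ∷ ts) = varCount x t + varCounts x ts

Ground : Term F ar → Set
Ground t = vars t ≡ []

IsVar : Term F ar → Set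
IsVar t = ∃ λ x → t ≡ var x

IsTRS : List (Rule F ar) → Set
IsTRS R = All (λ ρ → ¬ IsVar (proj₁ ρ) × (∀ x → x ∈ vars (proj₂ ρ) → x ∈ vars (proj₁ ρ))) R

NonDuplicating : List (Rule F ar) → Set
NonDuplicating R = ∀ l r → (l , r) ∈ R → ∀ x → varCount x r ≤ varCount x l

NonCollapsing : List (Rule F ar) → Set
NonCollapsing R = ∀ l r → (l , r) ∈ R → ¬ IsVar r

data InCtx {F : Set} {ar : F → ℕ} (_↦_ : Term F ar → Term F ar → Set)
     : Term F ar → Term F ar → Set where
  here  : ∀ {s t} → s ↦ t → InCtx _↦_ s t
  under : ∀ {f ss t} (i : Fin (ar f)) → InCtx _↦_ (lookup ss i) t
        → InCtx _↦_ (fun f ss) (fun f (ss [ i ]≔ t))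

RootStep : RuleSet F ar → Term F ar → Term F ar → Set
RootStep {F} {ar} R s t = ∃ λ l → ∃ λ r → ∃ λ (σ : ℕ → Term F ar) →
  R (l , r) × s ≡ l ⟨ σ ⟩ × t ≡ r ⟨ σ ⟩

Step : RuleSet F ar → Term F ar → Term F ar → Set
Step R = InCtx (RootStep R)

_*·_·*_ : (A → A → Set) → (A → A → Set) → (A → A → Set) → A → A → Set
(r₁ *· r₂ ·* r₃) a b = ∃ λ a' → ∃ λ b' → Star r₁ a a' × r₂ a' b' × Star r₃ b' b

RelStep : List (Rule F ar) → List (Rule F ar) → Term F ar → Term F ar → Set
RelStep R S = Step ⟦ S ⟧ *· Step ⟦ R ⟧ ·* Step ⟦ S ⟧

data Iter {A : Set} (_⟶_ : A → A → Set) : ℕ → A → A → Set where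
  done : ∀ {a} → Iter _⟶_ 0 a a
  step : ∀ {k a b c} → a ⟶ b → Iter _⟶_ k b c → Iter _⟶_ (suc k) a c

TerminatingOn : (Term F ar → Term F ar → Set) → (Term F ar → Set) → Set
TerminatingOn _⟶_ L = ∀ t → L t → Acc (flip _⟶_) t

-- cp(n, ⟶, L) ≤ b   (cp is a supremum of derivation lengths)
CpAtMost : (Term F ar → Term F ar → Set) → (Term F ar → Set) → ℕ → ℕ → Set
CpAtMost _⟶_ L n b = ∀ t → L t → size t ≤ n → ∀ m u → Iter _⟶_ m t u → m ≤ b

LinearCp : (Term F ar → Term F ar → Set) → (Term F ar → Set) → Set
LinearCp _⟶_ L = ∃ λ C → ∃ λ n₀ → ∀ n → n₀ ≤ n → CpAtMost _⟶_ L n (C * n)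

arL : (F → ℕ) → F × ℕ → ℕ
arL ar (f , c) = ar f

TermL : (F : Set) → (F → ℕ) → Set
TermL F ar = Term (F × ℕ) (arL ar)

mutual
  lift : ℕ → Term F ar → TermL F ar
  lift c (var x) = var x
  lift c (fun f ts) = fun (f , c) (lifts c ts)

  lifts : ℕ → Vec (Term F ar) n → Vec (TermL F ar) n
  lifts c [] = []
  lifts c (t ∷ ts) = lift c t ∷ lifts c ts

mutual
  base : TermL F ar → Term F ar
  base (var x) = var x
  base (fun (f , c) ts) = fun f (bases ts)

  bases : Vec (TermL F ar) n → Vec (Term F ar) n
  bases [] = []
  bases (t ∷ ts) = base t ∷ bases ts

mutual
  heights : TermL F ar → List ℕ
  heights (var x) = []
  heights (fun (f , c) ts) = c ∷ heightss ts

  heightss : Vec (TermL F ar) n → List ℕ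
  heightss [] = []
  heightss (t ∷ ts) = heights t ++ heightss ts

-- height of the root symbol (only used for non-variable terms)
rootH : TermL F ar → ℕ
rootH (var x) = 0
rootH (fun (f , c) ts) = c

-- minimum of a list (only used for nonempty lists)
minℕ : List ℕ → ℕ
minℕ [] = 0
minℕ (x ∷ xs) = foldr _⊓_ x xs

matchRules : List (Rule F ar) → RuleSet (F × ℕ) (arL ar)
matchRules R (l' , r') = ∃ λ r → (base l' , r) ∈ R × r' ≡ lift (suc (minℕ (heights l'))) r

RTCond : TermL F ar → Term F ar → Set
RTCond l' r = fsize r ≤ fsize (base l') × lift (rootH l') (base l') ≡ l'

MATCHRT : ℕ → List (Rule F ar) → RuleSet (F × ℕ) (arL ar)
MATCHRT c S (l' , r') = ∃ λ r → (base l' , r) ∈ S × ∃ λ d → r' ≡ lift d r ×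
  ((RTCond l' r × d ≡ c ⊓ rootH l')
   ⊎ (¬ RTCond l' r × d ≡ minℕ (c ∷ lmap suc (heights l'))))

idArgs : {G : Set} {arG : G → ℕ} (k : ℕ) → Vec (Term G arG) k
idArgs k = tabulate (λ i → var (toℕ i))

RaiseRules : RuleSet (F × ℕ) (arL ar)
RaiseRules {F} {ar} (l , r) = ∃ λ (f : F) → ∃ λ c →
  l ≡ fun (f , c) (idArgs (ar f)) × r ≡ fun (f , suc c) (idArgs (ar f))

RaiseN : ℕ → TermL F ar → TermL F ar → Set
RaiseN {F} {ar} k s u = Iter (Step (RaiseRules {F} {ar})) k s u

IsLeastJoin : List (TermL F ar) → TermL F ar → Set
IsLeastJoin ss u = Σ (List ℕ) λ ks → Pointwise (λ s k → RaiseN k s u) ss ks ×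
  (∀ u' ks' → Pointwise (λ s k → RaiseN k s u') ss ks' → sum ks ≤ sum ks')

-- linear matching  l = C[x₁,…,xₙ], s = C[s₁,…,sₙ]; θ lists the pairs (xᵢ , sᵢ)
mutual
  data LMatch {F : Set} {ar : F → ℕ} : Term F ar → Term F ar → List (ℕ × Term F ar) → Set where
    mvar : ∀ x s → LMatch (var x) s ((x , s) ∷ [])
    mfun : ∀ f {ls ss θ} → LMatchs {F} {ar} {ar f} ls ss θ → LMatch (fun f ls) (fun f ss) θ

  data LMatchs {F : Set} {ar : F → ℕ} : {n : ℕ} → Vec (Term F ar) n → Vec (Term F ar) n
       → List (ℕ × Term F ar) → Set where
    []  : LMatchs [] [] []
    _∷_ : ∀ {n l s θ θ'} {ls ss : Vec (Term F ar) n}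
        → LMatch l s θ → LMatchs ls ss θ' → LMatchs (l ∷ ls) (s ∷ ss) (θ ++ θ')

valsOf : ℕ → List (ℕ × A) → List A
valsOf x [] = []
valsOf x ((y , s) ∷ θ) = if does (x ≟ y) then s ∷ valsOf x θ else valsOf x θ

RootStepL : RuleSet (F × ℕ) (arL ar) → TermL F ar → TermL F ar → Set
RootStepL {F} {ar} T s t = ∃ λ l → ∃ λ r → ∃ λ θ → ∃ λ (σ : ℕ → TermL F ar) →
  T (l , r) × LMatch l s θ ×
  (∀ x s₁ s₂ → (x , s₁) ∈ θ → (x , s₂) ∈ θ → base s₁ ≡ base s₂) ×
  (∀ x → (valsOf x θ ≢ [] → IsLeastJoin (valsOf x θ) (σ x))
       × (valsOf x θ ≡ [] → σ x ≡ var x)) ×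
  t ≡ r ⟨ σ ⟩

StepL : RuleSet (F × ℕ) (arL ar) → TermL F ar → TermL F ar → Set
StepL T = InCtx (RootStepL T)

MatchRTStep : ℕ → List (Rule F ar) → List (Rule F ar) → TermL F ar → TermL F ar → Set
MatchRTStep c R S = StepL (MATCHRT c S) *· StepL (matchRules R) ·* StepL (MATCHRT c S)

Succ : (Term F ar → Term F ar → Set) → (Term F ar → Set) → Term F ar → Set
Succ _⟶_ K t = Ground t × ∃ λ s → K s × Star _⟶_ s t

Lift0 : (Term F ar → Set) → TermL F ar → Set
Lift0 L s = ∃ λ u → L u × s ≡ lift 0 u

MatchRaiseRTBounded : List (Rule F ar) → List (Rule F ar) → (Term F ar → Set) → Set
MatchRaiseRTBounded R S L = ∃ λ c → ∀ t →
  Succ (MatchRTStep c R S) (Lift0 L) t → All (_≤ c) (heights t)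

module Submission where

-- Let c bound all heights reachable from lift₀(L).  Heights are turned into
-- weights by an antitone map W with W h = V (c ∸ h), where V grows fast enough
-- that a symbol of height h outweighs (size of any right-hand side) symbols of
-- height h + 1.  The weight of a lifted term is the sum of W over its symbols.
--
-- The proof simulates rewriting: if s' annotates s (base s' ≡ s) and s → t by a
-- rule of R (resp. S), then s' ⇝ t' by the corresponding rule of match(R)
-- (resp. MATCHRT^c(S)) for an annotation t' of t.  The substitution of that
-- step is built from pointwise maxima of heights, shown to be the least
-- Raise-join ↑ required by the definition of ⇝.  Since R ∪ S is
-- non-duplicating, the weight never increases along an S-step and strictly
-- decreases along an R-step whose result has heights ≤ c (this uses that R is
-- non-collapsing).  Boundedness supplies the height condition along every
-- simulated derivation from lift₀(t), so the weight of lift₀(t), at most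
-- |t| · V c, bounds every →_{R/S}-derivation from t.

open import Defs
open import Data.Nat using (ℕ; zero; suc; _+_; _*_; _∸_; _≤_; _<_; _⊓_; _⊔_; _≟_; _≤?_; z≤n; s≤s; s≤s⁻¹)
open import Data.Nat.Properties
open import Data.Nat.ListAction using (sum)
open import Data.Nat.ListAction.Properties using (sum-++)
open import Data.Fin using (Fin; toℕ) renaming (zero to fzero; suc to fsuc)
open import Data.Vec using (Vec; []; _∷_; lookup; tabulate; _[_]≔_)
open import Data.List using (List; []; _∷_; _++_; foldr) renaming (map to lmap)
open import Data.List.Properties using (map-++; map-∘; ++-conicalˡ; ++-conicalʳ)
open import Data.List.Membership.Propositional using (_∈_)
open import Data.List.Membership.Propositional.Properties using (∈-++⁺ˡ; ∈-++⁺ʳ; ∈-++⁻; ∈-map⁻)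
open import Data.List.Relation.Unary.Any using (here; there)
open import Data.List.Relation.Unary.All as All using (All; []; _∷_; all?)
open import Data.List.Relation.Unary.All.Properties using (++⁺; ++⁻ˡ; ++⁻ʳ)
open import Data.List.Relation.Binary.Pointwise using (Pointwise; []; _∷_)
open import Data.Product using (Σ; ∃; _×_; _,_; proj₁; proj₂)
open import Data.Sum using (_⊎_; inj₁; inj₂)
open import Data.Empty using (⊥-elim)
open import Relation.Nullary using (¬_; Dec; yes; no; does)
open import Data.Bool using (if_then_else_)
open import Relation.Nullary.Decidable using (dec-true; dec-false)
open import Relation.Binary.PropositionalEquality
open import Relation.Binary.Construct.Closure.ReflexiveTransitive using (Star; ε; _◅_; _◅◅_)
open import Induction.WellFounded using (Acc; acc)
open import Function using (flip; _∘_)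
open import Algebra.Properties.CommutativeSemigroup +-commutativeSemigroup using (interchange; x∙yz≈y∙xz)

private variable
  F : Set
  ar : F → ℕ
  n k : ℕ

infix 4 _◂_ _◂*_ _⊑_ _⊑*_

mutual
  -- s' ◂ s : the lifted term s' annotates s with heights (base s' ≡ s); the
  -- inductive form lets proofs recurse on both terms simultaneously.
  data _◂_ {F : Set} {ar : F → ℕ} : TermL F ar → Term F ar → Set where
    var◂ : ∀ x → var x ◂ var x
    fun◂ : ∀ f a {ss' ss} → ss' ◂* ss → fun (f , a) ss' ◂ fun f ss

  data _◂*_ {F : Set} {ar : F → ℕ} : {n : ℕ} → Vec (TermL F ar) n → Vec (Term F ar) n → Set where
    [] : [] ◂* []
    _∷_ : ∀ {n s' s} {ss' : Vec (TermL F ar) n} {ss : Vec (Term F ar) n}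
        → s' ◂ s → ss' ◂* ss → (s' ∷ ss') ◂* (s ∷ ss)

mutual
  ◂-base : {s' : TermL F ar} {s : Term F ar} → s' ◂ s → base s' ≡ s
  ◂-base (var◂ x) = refl
  ◂-base (fun◂ f a ps) = cong (fun f) (◂*-base ps)

  ◂*-base : {ss' : Vec (TermL F ar) n} {ss : Vec (Term F ar) n} → ss' ◂* ss → bases ss' ≡ ss
  ◂*-base [] = refl
  ◂*-base (p ∷ ps) = cong₂ _∷_ (◂-base p) (◂*-base ps)

mutual
  lift-◂ : ∀ h (t : Term F ar) → lift h t ◂ t
  lift-◂ h (var x) = var◂ x
  lift-◂ h (fun f ts) = fun◂ f h (lifts-◂* h ts)

  lifts-◂* : ∀ h (ts : Vec (Term F ar) n) → lifts h ts ◂* ts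
  lifts-◂* h [] = []
  lifts-◂* h (t ∷ ts) = lift-◂ h t ∷ lifts-◂* h ts

mutual
  ◂-vars : {s' : TermL F ar} {s : Term F ar} → s' ◂ s → vars s' ≡ vars s
  ◂-vars (var◂ x) = refl
  ◂-vars (fun◂ f a ps) = ◂*-vars ps

  ◂*-vars : {ss' : Vec (TermL F ar) n} {ss : Vec (Term F ar) n} → ss' ◂* ss → varss ss' ≡ varss ss
  ◂*-vars [] = refl
  ◂*-vars (p ∷ ps) = cong₂ _++_ (◂-vars p) (◂*-vars ps)

◂*-lookup : {ss' : Vec (TermL F ar) n} {ss : Vec (Term F ar) n} → ss' ◂* ss → (i : Fin n)
  → lookup ss' i ◂ lookup ss i
◂*-lookup (p ∷ ps) fzero = p
◂*-lookup (p ∷ ps) (fsuc i) = ◂*-lookup ps i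

◂*-update : {ss' : Vec (TermL F ar) n} {ss : Vec (Term F ar) n} → ss' ◂* ss → (i : Fin n)
  → ∀ {t' t} → t' ◂ t → (ss' [ i ]≔ t') ◂* (ss [ i ]≔ t)
◂*-update (p ∷ ps) fzero q = q ∷ ps
◂*-update (p ∷ ps) (fsuc i) q = p ∷ ◂*-update ps i q

mutual
  liftSubst-◂ : ∀ d (r : Term F ar) (τ : ℕ → TermL F ar) σ → (∀ x → x ∈ vars r → τ x ◂ σ x)
    → lift d r ⟨ τ ⟩ ◂ r ⟨ σ ⟩
  liftSubst-◂ d (var x) τ σ τ◂σ = τ◂σ x (here refl)
  liftSubst-◂ d (fun f rs) τ σ τ◂σ = fun◂ f d (liftsSubst-◂* d rs τ σ τ◂σ)

  liftsSubst-◂* : ∀ d (rs : Vec (Term F ar) n) (τ : ℕ → TermL F ar) σ → (∀ x → x ∈ varss rs → τ x ◂ σ x)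
    → lifts d rs ⟨ τ ⟩* ◂* rs ⟨ σ ⟩*
  liftsSubst-◂* d [] τ σ τ◂σ = []
  liftsSubst-◂* d (r ∷ rs) τ σ τ◂σ =
    liftSubst-◂ d r τ σ (λ x x∈ → τ◂σ x (∈-++⁺ˡ x∈)) ∷ liftsSubst-◂* d rs τ σ (λ x x∈ → τ◂σ x (∈-++⁺ʳ (vars r) x∈))

mutual
  subst-ground⁻ : ∀ (l : Term F ar) σ → Ground (l ⟨ σ ⟩) → ∀ x → x ∈ vars l → Ground (σ x)
  subst-ground⁻ (var y) σ g x (here refl) = g
  subst-ground⁻ (fun f ls) σ g x x∈ = substs-ground⁻ ls σ g x x∈

  substs-ground⁻ : ∀ (ls : Vec (Term F ar) n) σ → varss (ls ⟨ σ ⟩*) ≡ [] → ∀ x → x ∈ varss ls → Ground (σ x)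
  substs-ground⁻ (l ∷ ls) σ g x x∈ with ∈-++⁻ (vars l) x∈
  ... | inj₁ x∈l = subst-ground⁻ l σ (++-conicalˡ _ _ g) x x∈l
  ... | inj₂ x∈ls = substs-ground⁻ ls σ (++-conicalʳ (vars (l ⟨ σ ⟩)) _ g) x x∈ls

mutual
  subst-ground : ∀ (r : Term F ar) σ → (∀ x → x ∈ vars r → Ground (σ x)) → Ground (r ⟨ σ ⟩)
  subst-ground (var y) σ g = g y (here refl)
  subst-ground (fun f rs) σ g = substs-ground rs σ g

  substs-ground : ∀ (rs : Vec (Term F ar) n) σ → (∀ x → x ∈ varss rs → Ground (σ x)) → varss (rs ⟨ σ ⟩*) ≡ []
  substs-ground [] σ g = refl
  substs-ground (r ∷ rs) σ g
    rewrite subst-ground r σ (λ x x∈ → g x (∈-++⁺ˡ x∈)) = substs-ground rs σ (λ x x∈ → g x (∈-++⁺ʳ (vars r) x∈))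

lookup-ground : (ss : Vec (Term F ar) n) (i : Fin n) → varss ss ≡ [] → Ground (lookup ss i)
lookup-ground (s ∷ ss) fzero g = ++-conicalˡ _ _ g
lookup-ground (s ∷ ss) (fsuc i) g = lookup-ground ss i (++-conicalʳ (vars s) _ g)

update-ground : (ss : Vec (Term F ar) n) (i : Fin n) {t : Term F ar} → varss ss ≡ [] → Ground t
  → varss (ss [ i ]≔ t) ≡ []
update-ground (s ∷ ss) fzero g gt rewrite gt = ++-conicalʳ (vars s) _ g
update-ground (s ∷ ss) (fsuc i) g gt rewrite ++-conicalˡ (vars s) _ g = update-ground ss i (++-conicalʳ (vars s) _ g) gt

step-ground : {T : List (Rule F ar)} → IsTRS T → {s t : Term F ar} → Step ⟦ T ⟧ s t → Ground s → Ground t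
step-ground isT (here (l , r , σ , l→r∈T , refl , refl)) g =
  subst-ground r σ (λ x x∈r → subst-ground⁻ l σ g x (proj₂ (All.lookup isT l→r∈T) x x∈r))
step-ground isT (under {ss = ss} i st) g = update-ground ss i g (step-ground isT st (lookup-ground ss i g))

mutual
  data _⊑_ {F : Set} {ar : F → ℕ} : TermL F ar → TermL F ar → Set where
    var⊑ : ∀ x → var x ⊑ var x
    fun⊑ : ∀ f {a b ss us} → a ≤ b → _⊑*_ {F} {ar} ss us → fun (f , a) ss ⊑ fun (f , b) us

  data _⊑*_ {F : Set} {ar : F → ℕ} : {n : ℕ} → Vec (TermL F ar) n → Vec (TermL F ar) n → Set where
    [] : [] ⊑* []
    _∷_ : ∀ {n s u} {ss us : Vec (TermL F ar) n} → s ⊑ u → ss ⊑* us → (s ∷ ss) ⊑* (u ∷ us)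

mutual
  ⊑-refl : (s : TermL F ar) → s ⊑ s
  ⊑-refl (var x) = var⊑ x
  ⊑-refl (fun (f , a) ss) = fun⊑ f ≤-refl (⊑*-refl ss)

  ⊑*-refl : (ss : Vec (TermL F ar) n) → ss ⊑* ss
  ⊑*-refl [] = []
  ⊑*-refl (s ∷ ss) = ⊑-refl s ∷ ⊑*-refl ss

mutual
  ⊑-trans : {s u w : TermL F ar} → s ⊑ u → u ⊑ w → s ⊑ w
  ⊑-trans (var⊑ x) (var⊑ .x) = var⊑ x
  ⊑-trans (fun⊑ f p ps) (fun⊑ .f q qs) = fun⊑ f (≤-trans p q) (⊑*-trans ps qs)

  ⊑*-trans : {ss us ws : Vec (TermL F ar) n} → ss ⊑* us → us ⊑* ws → ss ⊑* ws
  ⊑*-trans [] [] = []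
  ⊑*-trans (p ∷ ps) (q ∷ qs) = ⊑-trans p q ∷ ⊑*-trans ps qs

mutual
  -- the sum of all heights; every Raise step increases it by one
  heightSum : TermL F ar → ℕ
  heightSum (var x) = 0
  heightSum (fun (f , a) ts) = a + heightSums ts

  heightSums : Vec (TermL F ar) n → ℕ
  heightSums [] = 0
  heightSums (t ∷ ts) = heightSum t + heightSums ts

mutual
  -- the number of Raise steps needed to go from s to u when s ⊑ u
  gap : {s u : TermL F ar} → s ⊑ u → ℕ
  gap (var⊑ x) = 0
  gap (fun⊑ f {a} {b} _ ps) = (b ∸ a) + gaps ps

  gaps : {ss us : Vec (TermL F ar) n} → ss ⊑* us → ℕ
  gaps [] = 0
  gaps (p ∷ ps) = gap p + gaps ps

mutual
  gap-heightSum : {s u : TermL F ar} (p : s ⊑ u) → heightSum s + gap p ≡ heightSum u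
  gap-heightSum (var⊑ x) = refl
  gap-heightSum (fun⊑ f {a} {b} {ss} a≤b ps) = begin
    (a + heightSums ss) + ((b ∸ a) + gaps ps) ≡⟨ interchange a (heightSums ss) (b ∸ a) (gaps ps) ⟩
    (a + (b ∸ a)) + (heightSums ss + gaps ps) ≡⟨ cong₂ _+_ (m+[n∸m]≡n a≤b) (gaps-heightSums ps) ⟩
    _                                         ∎
    where open ≡-Reasoning

  gaps-heightSums : {ss us : Vec (TermL F ar) n} (ps : ss ⊑* us) → heightSums ss + gaps ps ≡ heightSums us
  gaps-heightSums [] = refl
  gaps-heightSums (_∷_ {s = s} {ss = ss} p ps) = begin
    (heightSum s + heightSums ss) + (gap p + gaps ps) ≡⟨ interchange (heightSum s) (heightSums ss) (gap p) (gaps ps) ⟩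
    (heightSum s + gap p) + (heightSums ss + gaps ps) ≡⟨ cong₂ _+_ (gap-heightSum p) (gaps-heightSums ps) ⟩
    _                                                 ∎
    where open ≡-Reasoning

⊑-heightSum : {s u : TermL F ar} → s ⊑ u → heightSum s ≤ heightSum u
⊑-heightSum {s = s} p = subst (heightSum s ≤_) (gap-heightSum p) (m≤m+n (heightSum s) (gap p))

RaiseStep : TermL F ar → TermL F ar → Set
RaiseStep {F} {ar} = Step (RaiseRules {F} {ar})

iter-++ : ∀ {A : Set} {_⟶_ : A → A → Set} {k k' a b c}
  → Iter _⟶_ k a b → Iter _⟶_ k' b c → Iter _⟶_ (k + k') a c
iter-++ done q = q
iter-++ (step x p) q = step x (iter-++ p q)

fromVec : ∀ {G : Set} {arG : G → ℕ} → Vec (Term G arG) k → ℕ → Term G arG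
fromVec [] _ = var 0
fromVec (t ∷ ts) zero = t
fromVec (t ∷ ts) (suc i) = fromVec ts i

tabulate-subst : ∀ {G : Set} {arG : G → ℕ} {k} (g : Fin k → Term G arG) σ
  → tabulate g ⟨ σ ⟩* ≡ tabulate (λ i → g i ⟨ σ ⟩)
tabulate-subst {k = zero} g σ = refl
tabulate-subst {k = suc k} g σ = cong (g fzero ⟨ σ ⟩ ∷_) (tabulate-subst (g ∘ fsuc) σ)

tabulate-fromVec : ∀ {G : Set} {arG : G → ℕ} {k} (ts : Vec (Term G arG) k) → tabulate (fromVec ts ∘ toℕ) ≡ ts
tabulate-fromVec [] = refl
tabulate-fromVec (t ∷ ts) = cong (t ∷_) (tabulate-fromVec ts)

idArgs-fromVec : ∀ {G : Set} {arG : G → ℕ} {k} (ts : Vec (Term G arG) k) → idArgs k ⟨ fromVec ts ⟩* ≡ ts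
idArgs-fromVec ts = trans (tabulate-subst (var ∘ toℕ) (fromVec ts)) (tabulate-fromVec ts)

raiseRoot : ∀ (f : F) a (ss : Vec (TermL F ar) (ar f)) → RaiseStep (fun (f , a) ss) (fun (f , suc a) ss)
raiseRoot {ar = ar} f a ss = here (fun (f , a) (idArgs (ar f)) , fun (f , suc a) (idArgs (ar f)) , fromVec ss ,
  (f , a , refl , refl) , cong (fun (f , a)) (sym (idArgs-fromVec ss)) , cong (fun (f , suc a)) (sym (idArgs-fromVec ss)))

raiseRootBy : ∀ k (f : F) a (ss : Vec (TermL F ar) (ar f)) → RaiseN k (fun (f , a) ss) (fun (f , a + k) ss)
raiseRootBy zero f a ss rewrite +-identityʳ a = done
raiseRootBy (suc k) f a ss rewrite +-suc a k = step (raiseRoot f a ss) (raiseRootBy k f (suc a) ss)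

data ArgRaise {F : Set} {ar : F → ℕ} {n : ℕ} : Vec (TermL F ar) n → Vec (TermL F ar) n → Set where
  argRaise : ∀ {ss} i {t} → RaiseStep (lookup ss i) t → ArgRaise ss (ss [ i ]≔ t)

underRoot : ∀ {g : F × ℕ} {ss us : Vec (TermL F ar) (arL ar g)} → Iter ArgRaise k ss us
  → RaiseN k (fun g ss) (fun g us)
underRoot done = done
underRoot (step (argRaise i st) it) = step (under i st) (underRoot it)

inHead : ∀ {a b : TermL F ar} {ss : Vec (TermL F ar) n} → RaiseN k a b → Iter ArgRaise k (a ∷ ss) (b ∷ ss)
inHead done = done
inHead (step st it) = step (argRaise fzero st) (inHead it)

inTail : ∀ {a : TermL F ar} {ss us : Vec (TermL F ar) n} → Iter ArgRaise k ss us → Iter ArgRaise k (a ∷ ss) (a ∷ us)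
inTail done = done
inTail (step (argRaise i st) it) = step (argRaise (fsuc i) st) (inTail it)

mutual
  ⊑⇒raise : {s u : TermL F ar} (p : s ⊑ u) → RaiseN (gap p) s u
  ⊑⇒raise (var⊑ x) = done
  ⊑⇒raise (fun⊑ f {a} {b} {ss} a≤b ps) =
    iter-++ (subst (λ h → RaiseN (b ∸ a) (fun (f , a) ss) (fun (f , h) ss)) (m+[n∸m]≡n a≤b) (raiseRootBy (b ∸ a) f a ss))
            (underRoot (⊑*⇒raise ps))

  ⊑*⇒raise : {ss us : Vec (TermL F ar) n} (ps : ss ⊑* us) → Iter ArgRaise (gaps ps) ss us
  ⊑*⇒raise [] = done
  ⊑*⇒raise (p ∷ ps) = iter-++ (inHead (⊑⇒raise p)) (inTail (⊑*⇒raise ps))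

update-⊑* : (ss : Vec (TermL F ar) n) (i : Fin n) {t : TermL F ar}
  → lookup ss i ⊑ t → suc (heightSum (lookup ss i)) ≡ heightSum t
  → (ss ⊑* (ss [ i ]≔ t)) × suc (heightSums ss) ≡ heightSums (ss [ i ]≔ t)
update-⊑* (s ∷ ss) fzero p e = (p ∷ ⊑*-refl ss) , cong (_+ heightSums ss) e
update-⊑* (s ∷ ss) (fsuc i) p e with update-⊑* ss i p e
... | ps , e' = (⊑-refl s ∷ ps) , trans (sym (+-suc (heightSum s) (heightSums ss))) (cong (heightSum s +_) e')

raiseStep⇒⊑ : {s v : TermL F ar} → RaiseStep s v → s ⊑ v × suc (heightSum s) ≡ heightSum v
raiseStep⇒⊑ (here (_ , _ , _ , (f , c , refl , refl) , refl , refl)) = fun⊑ f (n≤1+n c) (⊑*-refl _) , refl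
raiseStep⇒⊑ (under {f = f , a} {ss} i st) with raiseStep⇒⊑ st
... | p , e with update-⊑* ss i p e
... | ps , e' = fun⊑ f ≤-refl ps , trans (sym (+-suc a (heightSums ss))) (cong (a +_) e')

raise⇒⊑ : {s u : TermL F ar} → RaiseN k s u → s ⊑ u × heightSum s + k ≡ heightSum u
raise⇒⊑ {s = s} done = ⊑-refl s , +-identityʳ (heightSum s)
raise⇒⊑ {k = suc k} {s = s} (step st it) with raiseStep⇒⊑ st | raise⇒⊑ it
... | p , e | q , e' = ⊑-trans p q , trans (+-suc (heightSum s) k) (trans (cong (_+ k) e) e')

mutual
  join : {s u : TermL F ar} {b : Term F ar} → s ◂ b → u ◂ b → TermL F ar
  join (var◂ x) (var◂ .x) = var x
  join (fun◂ f a ps) (fun◂ .f a' qs) = fun (f , a ⊔ a') (join* ps qs)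

  join* : {ss us : Vec (TermL F ar) n} {bs : Vec (Term F ar) n} → ss ◂* bs → us ◂* bs → Vec (TermL F ar) n
  join* [] [] = []
  join* (p ∷ ps) (q ∷ qs) = join p q ∷ join* ps qs

mutual
  join-◂ : {s u : TermL F ar} {b : Term F ar} (p : s ◂ b) (q : u ◂ b) → join p q ◂ b
  join-◂ (var◂ x) (var◂ .x) = var◂ x
  join-◂ (fun◂ f a ps) (fun◂ .f a' qs) = fun◂ f (a ⊔ a') (join*-◂ ps qs)

  join*-◂ : {ss us : Vec (TermL F ar) n} {bs : Vec (Term F ar) n} (ps : ss ◂* bs) (qs : us ◂* bs) → join* ps qs ◂* bs
  join*-◂ [] [] = []
  join*-◂ (p ∷ ps) (q ∷ qs) = join-◂ p q ∷ join*-◂ ps qs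

mutual
  join-upperˡ : {s u : TermL F ar} {b : Term F ar} (p : s ◂ b) (q : u ◂ b) → s ⊑ join p q
  join-upperˡ (var◂ x) (var◂ .x) = var⊑ x
  join-upperˡ (fun◂ f a ps) (fun◂ .f a' qs) = fun⊑ f (m≤m⊔n a a') (join*-upperˡ ps qs)

  join*-upperˡ : {ss us : Vec (TermL F ar) n} {bs : Vec (Term F ar) n} (ps : ss ◂* bs) (qs : us ◂* bs) → ss ⊑* join* ps qs
  join*-upperˡ [] [] = []
  join*-upperˡ (p ∷ ps) (q ∷ qs) = join-upperˡ p q ∷ join*-upperˡ ps qs

mutual
  join-upperʳ : {s u : TermL F ar} {b : Term F ar} (p : s ◂ b) (q : u ◂ b) → u ⊑ join p q
  join-upperʳ (var◂ x) (var◂ .x) = var⊑ x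
  join-upperʳ (fun◂ f a ps) (fun◂ .f a' qs) = fun⊑ f (m≤n⊔m a a') (join*-upperʳ ps qs)

  join*-upperʳ : {ss us : Vec (TermL F ar) n} {bs : Vec (Term F ar) n} (ps : ss ◂* bs) (qs : us ◂* bs) → us ⊑* join* ps qs
  join*-upperʳ [] [] = []
  join*-upperʳ (p ∷ ps) (q ∷ qs) = join-upperʳ p q ∷ join*-upperʳ ps qs

mutual
  join-least : {s u w : TermL F ar} {b : Term F ar} (p : s ◂ b) (q : u ◂ b) → s ⊑ w → u ⊑ w → join p q ⊑ w
  join-least (var◂ x) (var◂ .x) (var⊑ .x) _ = var⊑ x
  join-least (fun◂ f a ps) (fun◂ .f a' qs) (fun⊑ .f a≤ ps⊑) (fun⊑ .f a'≤ qs⊑) = fun⊑ f (⊔-lub a≤ a'≤) (join*-least ps qs ps⊑ qs⊑)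

  join*-least : {ss us ws : Vec (TermL F ar) n} {bs : Vec (Term F ar) n} (ps : ss ◂* bs) (qs : us ◂* bs)
    → ss ⊑* ws → us ⊑* ws → join* ps qs ⊑* ws
  join*-least [] [] [] [] = []
  join*-least (p ∷ ps) (q ∷ qs) (p⊑ ∷ ps⊑) (q⊑ ∷ qs⊑) = join-least p q p⊑ q⊑ ∷ join*-least ps qs ps⊑ qs⊑

mutual
  joinAll : {s : TermL F ar} {b : Term F ar} → s ◂ b → {ss : List (TermL F ar)} → All (_◂ b) ss → TermL F ar
  joinAll {s = s} p [] = s
  joinAll p (q ∷ qs) = join p (joinAll-◂ q qs)

  joinAll-◂ : {s : TermL F ar} {b : Term F ar} (p : s ◂ b) {ss : List (TermL F ar)} (qs : All (_◂ b) ss) → joinAll p qs ◂ b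
  joinAll-◂ p [] = p
  joinAll-◂ p (q ∷ qs) = join-◂ p (joinAll-◂ q qs)

joinAll-upper : {s : TermL F ar} {b : Term F ar} (p : s ◂ b) {ss : List (TermL F ar)} (qs : All (_◂ b) ss)
  → All (_⊑ joinAll p qs) (s ∷ ss)
joinAll-upper {s = s} p [] = ⊑-refl s ∷ []
joinAll-upper p (q ∷ qs) =
  join-upperˡ p _ ∷ All.map (λ le → ⊑-trans le (join-upperʳ p (joinAll-◂ q qs))) (joinAll-upper q qs)

joinAll-least : {s w : TermL F ar} {b : Term F ar} (p : s ◂ b) {ss : List (TermL F ar)} (qs : All (_◂ b) ss)
  → All (_⊑ w) (s ∷ ss) → joinAll p qs ⊑ w
joinAll-least p [] (le ∷ []) = le
joinAll-least p (q ∷ qs) (le ∷ les) = join-least p (joinAll-◂ q qs) le (joinAll-least q qs les)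

-- the ⊑-least upper bound u of ss is the Raise-join ↑ ss: the Raise sequences
-- to u have lengths gap, and any other join u' lies above u, so it needs at
-- least as many steps from each member of ss
⊑-lub⇒leastJoin : (ss : List (TermL F ar)) (u : TermL F ar) → All (_⊑ u) ss
  → (∀ u' → All (_⊑ u') ss → u ⊑ u') → IsLeastJoin ss u
⊑-lub⇒leastJoin {F = F} {ar = ar} ss u ss⊑u least = gapsTo ss⊑u , raisesTo ss⊑u , λ u' _ raises' →
    fewerSteps ss⊑u raises' (⊑-heightSum (least u' (raisesUpper raises')))
  where
  gapsTo : {ss : List (TermL F ar)} → All (_⊑ u) ss → List ℕ
  gapsTo [] = []
  gapsTo (p ∷ ps) = gap p ∷ gapsTo ps

  raisesTo : {ss : List (TermL F ar)} (ps : All (_⊑ u) ss) → Pointwise (λ s k → RaiseN k s u) ss (gapsTo ps)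
  raisesTo [] = []
  raisesTo (p ∷ ps) = ⊑⇒raise p ∷ raisesTo ps

  raisesUpper : {u' : TermL F ar} {ss : List (TermL F ar)} {ks : List ℕ} → Pointwise (λ s k → RaiseN k s u') ss ks → All (_⊑ u') ss
  raisesUpper [] = []
  raisesUpper (r ∷ rs) = proj₁ (raise⇒⊑ r) ∷ raisesUpper rs

  fewerSteps : {u' : TermL F ar} {ss : List (TermL F ar)} {ks : List ℕ} (ps : All (_⊑ u) ss) → Pointwise (λ s k → RaiseN k s u') ss ks
    → heightSum u ≤ heightSum u' → sum (gapsTo ps) ≤ sum ks
  fewerSteps [] [] _ = z≤n
  fewerSteps (_∷_ {x = s} p ps) (_∷_ {y = k} r rs) u≤u' = +-mono-≤ gap≤k (fewerSteps ps rs u≤u')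
    where
    gap≤k : gap p ≤ k
    gap≤k = +-cancelˡ-≤ (heightSum s) (gap p) k
      (subst₂ _≤_ (sym (gap-heightSum p)) (sym (proj₂ (raise⇒⊑ r))) u≤u')

-- ↑ ss for a list of annotations of one term (var x for the empty list, as
-- required for variables not bound by a match)
joinOrVar : ℕ → {b : Term F ar} (ss : List (TermL F ar)) → All (_◂ b) ss → TermL F ar
joinOrVar x [] [] = var x
joinOrVar x (s ∷ ss) (p ∷ ps) = joinAll p ps

joinOrVar-◂ : ∀ x {b : Term F ar} (ss : List (TermL F ar)) (ps : All (_◂ b) ss) → ss ≢ [] → joinOrVar x ss ps ◂ b
joinOrVar-◂ x [] [] ne = ⊥-elim (ne refl)
joinOrVar-◂ x (s ∷ ss) (p ∷ ps) ne = joinAll-◂ p ps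

joinOrVar-upper : ∀ x {b : Term F ar} (ss : List (TermL F ar)) (ps : All (_◂ b) ss) → All (_⊑ joinOrVar x ss ps) ss
joinOrVar-upper x [] [] = []
joinOrVar-upper x (s ∷ ss) (p ∷ ps) = joinAll-upper p ps

joinOrVar-least : ∀ x {b : Term F ar} (ss : List (TermL F ar)) (ps : All (_◂ b) ss) → ss ≢ [] → IsLeastJoin ss (joinOrVar x ss ps)
joinOrVar-least x [] [] ne = ⊥-elim (ne refl)
joinOrVar-least x (s ∷ ss) (p ∷ ps) ne = ⊑-lub⇒leastJoin (s ∷ ss) _ (joinAll-upper p ps) (λ u' → joinAll-least p ps)

joinOrVar-[] : ∀ x {b : Term F ar} (ss : List (TermL F ar)) (ps : All (_◂ b) ss) → ss ≡ [] → joinOrVar x ss ps ≡ var x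
joinOrVar-[] x [] [] refl = refl

indicator : ℕ → ℕ → ℕ
indicator z y = if does (z ≟ y) then 1 else 0

indicator-≡ : ∀ x → indicator x x ≡ 1
indicator-≡ x rewrite dec-true (x ≟ x) refl = refl

indicator-≢ : ∀ {x y} → x ≢ y → indicator x y ≡ 0
indicator-≢ {x} {y} x≢y rewrite dec-false (x ≟ y) x≢y = refl

occ : ℕ → List ℕ → ℕ
occ z [] = 0
occ z (y ∷ ys) = indicator z y + occ z ys

occ-++ : ∀ z xs ys → occ z (xs ++ ys) ≡ occ z xs + occ z ys
occ-++ z [] ys = refl
occ-++ z (y ∷ xs) ys = trans (cong (indicator z y +_) (occ-++ z xs ys)) (sym (+-assoc (indicator z y) _ _))

mutual
  varCount≡occ : ∀ x (t : Term F ar) → varCount x t ≡ occ x (vars t)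
  varCount≡occ x (var y) = sym (+-identityʳ _)
  varCount≡occ x (fun f ts) = varCounts≡occ x ts

  varCounts≡occ : ∀ x (ts : Vec (Term F ar) n) → varCounts x ts ≡ occ x (varss ts)
  varCounts≡occ x [] = refl
  varCounts≡occ x (t ∷ ts) = trans (cong₂ _+_ (varCount≡occ x t) (varCounts≡occ x ts)) (sym (occ-++ x (vars t) _))

occ-head : ∀ x xs → 1 ≤ occ x (x ∷ xs)
occ-head x xs = subst (1 ≤_) (cong (_+ occ x xs) (sym (indicator-≡ x))) (s≤s z≤n)

module _ (g : ℕ → ℕ) where

  removeOcc : ∀ x ys → 1 ≤ occ x ys → Σ (List ℕ) λ ys' →
    sum (lmap g ys) ≡ g x + sum (lmap g ys') × (∀ z → occ z ys ≡ indicator z x + occ z ys')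
  removeOcc x (y ∷ ys) x∈ys with x ≟ y
  ... | yes refl = ys , refl , λ z → refl
  ... | no x≢y with removeOcc x ys (subst (1 ≤_) (cong (_+ occ x ys) (indicator-≢ x≢y)) x∈ys)
  ... | ys' , sum≡ , occ≡ = y ∷ ys' , trans (cong (g y +_) sum≡) (x∙yz≈y∙xz (g y) (g x) _) ,
        λ z → trans (cong (indicator z y +_) (occ≡ z)) (x∙yz≈y∙xz (indicator z y) (indicator z x) _)

  sum-subMultiset : ∀ xs ys → (∀ z → occ z xs ≤ occ z ys) → sum (lmap g xs) ≤ sum (lmap g ys)
  sum-subMultiset [] ys _ = z≤n
  sum-subMultiset (x ∷ xs) ys xs⊆ys with removeOcc x ys (≤-trans (occ-head x xs) (xs⊆ys x))
  ... | ys' , sum≡ , occ≡ = subst (g x + sum (lmap g xs) ≤_) (sym sum≡) (+-monoʳ-≤ (g x) (sum-subMultiset xs ys' xs⊆ys'))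
    where
    xs⊆ys' : ∀ z → occ z xs ≤ occ z ys'
    xs⊆ys' z = +-cancelˡ-≤ (indicator z x) _ _ (subst (indicator z x + occ z xs ≤_) (occ≡ z) (xs⊆ys z))

sum-map-mono : ∀ {A : Set} (f h : A → ℕ) (xs : List A) → (∀ a → a ∈ xs → f a ≤ h a) → sum (lmap f xs) ≤ sum (lmap h xs)
sum-map-mono f h [] _ = z≤n
sum-map-mono f h (x ∷ xs) f≤h = +-mono-≤ (f≤h x (here refl)) (sum-map-mono f h xs (λ a a∈ → f≤h a (there a∈)))

∈⇒≤sum-map : ∀ {A : Set} (f : A → ℕ) {x} {xs : List A} → x ∈ xs → f x ≤ sum (lmap f xs)
∈⇒≤sum-map f (here refl) = m≤m+n _ _
∈⇒≤sum-map f {xs = y ∷ xs} (there x∈) = ≤-trans (∈⇒≤sum-map f x∈) (m≤n+m _ (f y))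

valsOf-≡ : ∀ {A : Set} x (a : A) θ → valsOf x ((x , a) ∷ θ) ≡ a ∷ valsOf x θ
valsOf-≡ x a θ rewrite dec-true (x ≟ x) refl = refl

valsOf-≢ : ∀ {A : Set} {x y} (a : A) θ → x ≢ y → valsOf x ((y , a) ∷ θ) ≡ valsOf x θ
valsOf-≢ {x = x} {y} a θ x≢y rewrite dec-false (x ≟ y) x≢y = refl

∈⇒∈valsOf : ∀ {A : Set} {θ : List (ℕ × A)} {y a} → (y , a) ∈ θ → a ∈ valsOf y θ
∈⇒∈valsOf {θ = (y , a) ∷ θ} (here refl) rewrite valsOf-≡ y a θ = here refl
∈⇒∈valsOf {θ = (y' , a') ∷ θ} {y} (there ya∈) with y ≟ y'
... | yes refl rewrite valsOf-≡ y a' θ = there (∈⇒∈valsOf ya∈)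
... | no y≢y' rewrite valsOf-≢ a' θ y≢y' = ∈⇒∈valsOf ya∈

valsOf-nonempty : ∀ {A : Set} {θ : List (ℕ × A)} {x} → x ∈ lmap proj₁ θ → valsOf x θ ≢ []
valsOf-nonempty {θ = (y , a) ∷ θ} {x} x∈ with x ≟ y
... | yes refl rewrite valsOf-≡ x a θ = λ ()
valsOf-nonempty {θ = (y , a) ∷ θ} (here x≡y) | no x≢y = ⊥-elim (x≢y x≡y)
valsOf-nonempty {θ = (y , a) ∷ θ} (there x∈) | no x≢y rewrite valsOf-≢ a θ x≢y = valsOf-nonempty x∈

valsOf-All : ∀ {A : Set} {Q : ℕ × A → Set} {θ : List (ℕ × A)} x → All Q θ → All (λ a → Q (x , a)) (valsOf x θ)
valsOf-All x [] = []
valsOf-All {θ = (y , a) ∷ θ} x (q ∷ qs) with x ≟ y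
... | yes refl rewrite valsOf-≡ x a θ = q ∷ valsOf-All x qs
... | no x≢y rewrite valsOf-≢ a θ x≢y = valsOf-All x qs

min-∈ : ∀ a xs → foldr _⊓_ a xs ∈ (a ∷ xs)
min-∈ a [] = here refl
min-∈ a (x ∷ xs) with ⊓-sel x (foldr _⊓_ a xs)
... | inj₁ e = there (here e)
... | inj₂ e with min-∈ a xs
... | here q = here (trans e q)
... | there q = there (there (subst (_∈ xs) (sym e) q))

min-≤ : ∀ a xs → foldr _⊓_ a xs ≤ a
min-≤ a [] = ≤-refl
min-≤ a (x ∷ xs) = ≤-trans (m⊓n≤n x _) (min-≤ a xs)

min-suc-cases : ∀ c hs → minℕ (c ∷ lmap suc hs) ≡ c ⊎ ∃ λ h → h ∈ hs × h < c × minℕ (c ∷ lmap suc hs) ≡ suc h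
min-suc-cases c hs with min-∈ c (lmap suc hs)
... | here e = inj₁ e
... | there m∈ with ∈-map⁻ suc m∈
...   | h , h∈hs , e = inj₂ (h , h∈hs , subst (_≤ c) e (min-≤ c (lmap suc hs)) , e)

mutual
  lift-uniform : ∀ h (t : Term F ar) → All (_≡ h) (heights (lift h t))
  lift-uniform h (var x) = []
  lift-uniform h (fun f ts) = refl ∷ lifts-uniform h ts

  lifts-uniform : ∀ h (ts : Vec (Term F ar) n) → All (_≡ h) (heightss (lifts h ts))
  lifts-uniform h [] = []
  lifts-uniform h (t ∷ ts) = ++⁺ (lift-uniform h t) (lifts-uniform h ts)

mutual
  uniform⇒lift : ∀ h (t : TermL F ar) → All (_≡ h) (heights t) → lift h (base t) ≡ t
  uniform⇒lift h (var x) _ = refl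
  uniform⇒lift h (fun (f , a) ts) (refl ∷ hs) = cong (fun (f , h)) (uniforms⇒lifts h ts hs)

  uniforms⇒lifts : ∀ h (ts : Vec (TermL F ar) n) → All (_≡ h) (heightss ts) → lifts h (bases ts) ≡ ts
  uniforms⇒lifts h [] _ = refl
  uniforms⇒lifts h (t ∷ ts) hs =
    cong₂ _∷_ (uniform⇒lift h t (++⁻ˡ (heights t) hs)) (uniforms⇒lifts h ts (++⁻ʳ (heights t) hs))

uniform? : ∀ h (t : TermL F ar) → Dec (lift h (base t) ≡ t)
uniform? h t with all? (_≟ h) (heights t)
... | yes hs = yes (uniform⇒lift h t hs)
... | no ¬hs = no (λ e → ¬hs (subst (λ t' → All (_≡ h) (heights t')) e (lift-uniform h (base t))))

RTCond? : (l' : TermL F ar) (r : Term F ar) → Dec (RTCond l' r)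
RTCond? l' r with fsize r ≤? fsize (base l') | uniform? (rootH l') l'
... | yes r≤l | yes unif = yes (r≤l , unif)
... | no r≰l | _ = no (r≰l ∘ proj₁)
... | yes _ | no ¬unif = no (¬unif ∘ proj₂)

update-heights : ∀ {Q : ℕ → Set} (ss : Vec (TermL F ar) n) (i : Fin n) {t : TermL F ar}
  → All Q (heightss (ss [ i ]≔ t)) → All Q (heights t)
update-heights (s ∷ ss) fzero qs = ++⁻ˡ _ qs
update-heights (s ∷ ss) (fsuc i) qs = update-heights ss i (++⁻ʳ (heights s) qs)

mutual
  fsize≤size : (t : Term F ar) → fsize t ≤ size t
  fsize≤size (var x) = z≤n
  fsize≤size (fun f ts) = s≤s (fsizes≤sizes ts)

  fsizes≤sizes : (ts : Vec (Term F ar) n) → fsizes ts ≤ sizes ts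
  fsizes≤sizes [] = z≤n
  fsizes≤sizes (t ∷ ts) = +-mono-≤ (fsize≤size t) (fsizes≤sizes ts)

∸-suc-split : ∀ c h → h < c → c ∸ h ≡ suc (c ∸ suc h)
∸-suc-split (suc c) zero _ = refl
∸-suc-split (suc c) (suc h) (s≤s h<c) = ∸-suc-split c h h<c

module Weights (W : ℕ → ℕ) (W-antitone : ∀ {a b} → a ≤ b → W b ≤ W a) where

  mutual
    weight : TermL F ar → ℕ
    weight (var x) = 0
    weight (fun (f , a) ts) = W a + weights ts

    weights : Vec (TermL F ar) n → ℕ
    weights [] = 0
    weights (t ∷ ts) = weight t + weights ts

  mutual
    ⊑-weight : {s u : TermL F ar} → s ⊑ u → weight u ≤ weight s
    ⊑-weight (var⊑ x) = ≤-refl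
    ⊑-weight (fun⊑ f a≤b ps) = +-mono-≤ (W-antitone a≤b) (⊑*-weights ps)

    ⊑*-weights : {ss us : Vec (TermL F ar) n} → ss ⊑* us → weights us ≤ weights ss
    ⊑*-weights [] = ≤-refl
    ⊑*-weights (p ∷ ps) = +-mono-≤ (⊑-weight p) (⊑*-weights ps)

  update-weights : (ss : Vec (TermL F ar) n) (i : Fin n) {t : TermL F ar}
    → weight t ≤ weight (lookup ss i) → weights (ss [ i ]≔ t) ≤ weights ss
  update-weights (s ∷ ss) fzero le = +-monoˡ-≤ (weights ss) le
  update-weights (s ∷ ss) (fsuc i) le = +-monoʳ-≤ (weight s) (update-weights ss i le)

  update-weights< : (ss : Vec (TermL F ar) n) (i : Fin n) {t : TermL F ar}
    → weight t < weight (lookup ss i) → weights (ss [ i ]≔ t) < weights ss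
  update-weights< (s ∷ ss) fzero lt = +-monoˡ-< (weights ss) lt
  update-weights< (s ∷ ss) (fsuc i) lt = +-monoʳ-< (weight s) (update-weights< ss i lt)

  mutual
    weight-liftSubst : ∀ d (r : Term F ar) (τ : ℕ → TermL F ar)
      → weight (lift d r ⟨ τ ⟩) ≡ fsize r * W d + sum (lmap (weight ∘ τ) (vars r))
    weight-liftSubst d (var x) τ = sym (+-identityʳ _)
    weight-liftSubst d (fun f rs) τ = trans (cong (W d +_) (weights-liftSubst d rs τ)) (sym (+-assoc (W d) _ _))

    weights-liftSubst : ∀ d (rs : Vec (Term F ar) n) (τ : ℕ → TermL F ar)
      → weights (lifts d rs ⟨ τ ⟩*) ≡ fsizes rs * W d + sum (lmap (weight ∘ τ) (varss rs))
    weights-liftSubst d [] τ = refl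
    weights-liftSubst d (r ∷ rs) τ = begin
      weight (lift d r ⟨ τ ⟩) + weights (lifts d rs ⟨ τ ⟩*)
        ≡⟨ cong₂ _+_ (weight-liftSubst d r τ) (weights-liftSubst d rs τ) ⟩
      (fsize r * W d + sum (ws (vars r))) + (fsizes rs * W d + sum (ws (varss rs)))
        ≡⟨ interchange (fsize r * W d) (sum (ws (vars r))) (fsizes rs * W d) _ ⟩
      (fsize r * W d + fsizes rs * W d) + (sum (ws (vars r)) + sum (ws (varss rs)))
        ≡⟨ cong₂ _+_ (sym (*-distribʳ-+ (W d) (fsize r) (fsizes rs)))
                     (trans (sym (sum-++ (ws (vars r)) _)) (cong sum (sym (map-++ (weight ∘ τ) (vars r) _)))) ⟩
      (fsize r + fsizes rs) * W d + sum (ws (vars r ++ varss rs)) ∎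
      where
      open ≡-Reasoning
      ws : List ℕ → List ℕ
      ws = lmap (weight ∘ τ)

  mutual
    weight-lift : ∀ h (t : Term F ar) → weight (lift h t) ≡ fsize t * W h
    weight-lift h (var x) = refl
    weight-lift h (fun f ts) = cong (W h +_) (weights-lifts h ts)

    weights-lifts : ∀ h (ts : Vec (Term F ar) n) → weights (lifts h ts) ≡ fsizes ts * W h
    weights-lifts h [] = refl
    weights-lifts h (t ∷ ts) = trans (cong₂ _+_ (weight-lift h t) (weights-lifts h ts)) (sym (*-distribʳ-+ (W h) (fsize t) (fsizes ts)))

  mutual
    height⇒W≤weight : ∀ {h} (t : TermL F ar) → h ∈ heights t → W h ≤ weight t
    height⇒W≤weight (fun (f , a) ts) (here refl) = m≤m+n (W a) (weights ts)
    height⇒W≤weight (fun (f , a) ts) (there h∈) = ≤-trans (heights⇒W≤weights ts h∈) (m≤n+m (weights ts) (W a))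

    heights⇒W≤weights : ∀ {h} (ts : Vec (TermL F ar) n) → h ∈ heightss ts → W h ≤ weights ts
    heights⇒W≤weights (t ∷ ts) h∈ with ∈-++⁻ (heights t) h∈
    ... | inj₁ h∈t = ≤-trans (height⇒W≤weight t h∈t) (m≤m+n _ _)
    ... | inj₂ h∈ts = ≤-trans (heights⇒W≤weights ts h∈ts) (m≤n+m _ _)

  W-minHeight≤weight : (t : TermL F ar) → ¬ IsVar (base t) → W (minℕ (heights t)) ≤ weight t
  W-minHeight≤weight (var x) nonVar = ⊥-elim (nonVar (x , refl))
  W-minHeight≤weight (fun (f , a) ts) _ = height⇒W≤weight (fun (f , a) ts) (min-∈ a (heightss ts))

  bindingWeight : List (ℕ × TermL F ar) → ℕ
  bindingWeight θ = sum (lmap (weight ∘ proj₂) θ)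

  bindingWeight-++ : (θ θ' : List (ℕ × TermL F ar)) → bindingWeight (θ ++ θ') ≡ bindingWeight θ + bindingWeight θ'
  bindingWeight-++ θ θ' = trans (cong sum (map-++ (weight ∘ proj₂) θ θ')) (sum-++ (lmap (weight ∘ proj₂) θ) _)

  record AnnotMatch (l : Term F ar) (σ : ℕ → Term F ar) (s' : TermL F ar) : Set where
    field
      lhs : TermL F ar
      θ : List (ℕ × TermL F ar)
      matches : LMatch lhs s' θ
      lhs-base : base lhs ≡ l
      θ-◂ : All (λ b → proj₂ b ◂ σ (proj₁ b)) θ
      weight-split : weight s' ≡ weight lhs + bindingWeight θ
      θ-vars : lmap proj₁ θ ≡ vars l

  record AnnotMatch* (ls : Vec (Term F ar) n) (σ : ℕ → Term F ar) (ss' : Vec (TermL F ar) n) : Set where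
    field
      lhss : Vec (TermL F ar) n
      θ : List (ℕ × TermL F ar)
      matches : LMatchs lhss ss' θ
      lhs-bases : bases lhss ≡ ls
      θ-◂ : All (λ b → proj₂ b ◂ σ (proj₁ b)) θ
      weight-split : weights ss' ≡ weights lhss + bindingWeight θ
      θ-vars : lmap proj₁ θ ≡ varss ls

  mutual
    annotMatch : (l : Term F ar) (σ : ℕ → Term F ar) {s' : TermL F ar} → s' ◂ l ⟨ σ ⟩ → AnnotMatch l σ s'
    annotMatch (var x) σ {s'} p = record
      { lhs = var x ; θ = (x , s') ∷ [] ; matches = mvar x s' ; lhs-base = refl ; θ-◂ = p ∷ []
      ; weight-split = sym (+-identityʳ _) ; θ-vars = refl }
    annotMatch (fun f ls) σ (fun◂ .f a ps) = record
      { lhs = fun (f , a) lhss ; θ = θ ; matches = mfun (f , a) matches ; lhs-base = cong (fun f) lhs-bases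
      ; θ-◂ = θ-◂ ; weight-split = trans (cong (W a +_) weight-split) (sym (+-assoc (W a) _ _)) ; θ-vars = θ-vars }
      where open AnnotMatch* (annotMatch* ls σ ps)

    annotMatch* : (ls : Vec (Term F ar) n) (σ : ℕ → Term F ar) {ss' : Vec (TermL F ar) n} → ss' ◂* ls ⟨ σ ⟩* → AnnotMatch* ls σ ss'
    annotMatch* [] σ [] = record
      { lhss = [] ; θ = [] ; matches = [] ; lhs-bases = refl ; θ-◂ = [] ; weight-split = refl ; θ-vars = refl }
    annotMatch* (l ∷ ls) σ {s' ∷ ss'} (p ∷ ps) = record
      { lhss = H.lhs ∷ T.lhss ; θ = H.θ ++ T.θ ; matches = H.matches ∷ T.matches
      ; lhs-bases = cong₂ _∷_ H.lhs-base T.lhs-bases ; θ-◂ = ++⁺ H.θ-◂ T.θ-◂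
      ; weight-split = begin
          weight s' + weights ss'
            ≡⟨ cong₂ _+_ H.weight-split T.weight-split ⟩
          (weight H.lhs + bindingWeight H.θ) + (weights T.lhss + bindingWeight T.θ)
            ≡⟨ interchange (weight H.lhs) (bindingWeight H.θ) (weights T.lhss) (bindingWeight T.θ) ⟩
          (weight H.lhs + weights T.lhss) + (bindingWeight H.θ + bindingWeight T.θ)
            ≡⟨ cong (weight H.lhs + weights T.lhss +_) (sym (bindingWeight-++ H.θ T.θ)) ⟩
          (weight H.lhs + weights T.lhss) + bindingWeight (H.θ ++ T.θ) ∎
      ; θ-vars = trans (map-++ proj₁ H.θ T.θ) (cong₂ _++_ H.θ-vars T.θ-vars) }
      where
      module H = AnnotMatch (annotMatch l σ p)
      module T = AnnotMatch* (annotMatch* ls σ ps)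
      open ≡-Reasoning

  -- The substitution of the simulating ⇝-step: σ' x is the least Raise-join of
  -- the terms bound to x.  Its instances of right-hand sides annotate the
  -- σ-instances, and σ' x weighs no more than any term bound to x, so for a
  -- non-duplicating rule the variables of r σ' weigh at most the bound terms.
  module JoinedSubst {l : Term F ar} {σ : ℕ → Term F ar} {s' : TermL F ar} (m : AnnotMatch l σ s') where
    open AnnotMatch m

    σ' : ℕ → TermL F ar
    σ' x = joinOrVar x (valsOf x θ) (valsOf-All x θ-◂)

    simulatedStep : ∀ {T : RuleSet (F × ℕ) (arL ar)} d r → T (lhs , lift d r) → RootStepL T s' (lift d r ⟨ σ' ⟩)
    simulatedStep d r rule =
      lhs , lift d r , θ , σ' , rule , matches , sameBase , (λ x → joinOrVar-least x _ _ , joinOrVar-[] x _ _) , refl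
      where
      sameBase : ∀ x s₁ s₂ → (x , s₁) ∈ θ → (x , s₂) ∈ θ → base s₁ ≡ base s₂
      sameBase x s₁ s₂ xs₁∈ xs₂∈ = trans (◂-base (All.lookup θ-◂ xs₁∈)) (sym (◂-base (All.lookup θ-◂ xs₂∈)))

    σ'-◂ : ∀ x → x ∈ vars l → σ' x ◂ σ x
    σ'-◂ x x∈l = joinOrVar-◂ x _ _ (valsOf-nonempty (subst (x ∈_) (sym θ-vars) x∈l))

    σ'-lighter : ∀ y s → (y , s) ∈ θ → weight (σ' y) ≤ weight s
    σ'-lighter y s ys∈ = ⊑-weight (All.lookup (joinOrVar-upper y _ (valsOf-All y θ-◂)) (∈⇒∈valsOf ys∈))

    result-◂ : ∀ d (r : Term F ar) → (∀ x → x ∈ vars r → x ∈ vars l) → lift d r ⟨ σ' ⟩ ◂ r ⟨ σ ⟩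
    result-◂ d r r⊆l = liftSubst-◂ d r σ' σ (λ x x∈r → σ'-◂ x (r⊆l x x∈r))

    varsWeight : (r : Term F ar) → (∀ x → occ x (vars r) ≤ occ x (vars l))
      → sum (lmap (weight ∘ σ') (vars r)) ≤ bindingWeight θ
    varsWeight r r⊆l = begin
      sum (lmap (weight ∘ σ') (vars r))               ≤⟨ sum-subMultiset (weight ∘ σ') (vars r) (vars l) r⊆l ⟩
      sum (lmap (weight ∘ σ') (vars l))               ≡⟨ cong (sum ∘ lmap (weight ∘ σ')) (sym θ-vars) ⟩
      sum (lmap (weight ∘ σ') (lmap proj₁ θ))         ≡⟨ cong sum (sym (map-∘ θ)) ⟩
      sum (lmap (weight ∘ σ' ∘ proj₁) θ)              ≤⟨ sum-map-mono _ _ θ (λ { (y , s) ys∈ → σ'-lighter y s ys∈ }) ⟩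
      bindingWeight θ                                 ∎
      where open ≤-Reasoning

    result-weight : ∀ d (r : Term F ar) → (∀ x → occ x (vars r) ≤ occ x (vars l))
      → weight (lift d r ⟨ σ' ⟩) ≤ fsize r * W d + bindingWeight θ
    result-weight d r r⊆l = begin
      weight (lift d r ⟨ σ' ⟩)                        ≡⟨ weight-liftSubst d r σ' ⟩
      fsize r * W d + sum (lmap (weight ∘ σ') (vars r)) ≤⟨ +-monoʳ-≤ (fsize r * W d) (varsWeight r r⊆l) ⟩
      fsize r * W d + bindingWeight θ                 ∎
      where open ≤-Reasoning

Simulates : (Term F ar → Term F ar → Set) → (TermL F ar → TermL F ar → Set) → (TermL F ar → TermL F ar → Set) → Set
Simulates {F} {ar} _⟶_ _⟹_ Q = ∀ {s t s'} → s ⟶ t → s' ◂ s → Σ (TermL F ar) λ t' → t' ◂ t × s' ⟹ t' × Q s' t'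

ContextClosed : (TermL F ar → TermL F ar → Set) → Set
ContextClosed {F} {ar} Q = ∀ f a (ss' : Vec (TermL F ar) (ar f)) (i : Fin (ar f)) {t'}
  → Q (lookup ss' i) t' → Q (fun (f , a) ss') (fun (f , a) (ss' [ i ]≔ t'))

simulateInContext : {T : RuleSet F ar} {T' : RuleSet (F × ℕ) (arL ar)} (Q : TermL F ar → TermL F ar → Set)
  → ContextClosed Q → Simulates (RootStep T) (RootStepL T') Q → Simulates (Step T) (StepL T') Q
simulateInContext Q closed root (here st) p with root st p
... | t' , t'◂t , st' , q = t' , t'◂t , here st' , q
simulateInContext Q closed root (under i st) (fun◂ f a {ss'} ps) with simulateInContext Q closed root st (◂*-lookup ps i)
... | t' , t'◂t , st' , q = _ , fun◂ f a (◂*-update ps i t'◂t) , under i st' , closed f a ss' i q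

module Simulation {F : Set} {ar : F → ℕ} (R S : List (Rule F ar)) (L : Term F ar → Set)
  (isR : IsTRS R) (isS : IsTRS S) (nonDup : NonDuplicating (R ++ S)) (nonColl : NonCollapsing R)
  (L-ground : ∀ t → L t → Ground t) (c : ℕ)
  (bounded : ∀ t → Succ (MatchRTStep c R S) (Lift0 L) t → All (_≤ c) (heights t)) where

  M : ℕ
  M = sum (lmap (fsize ∘ proj₂) (R ++ S))

  rhs≤M : ∀ {l r} → (l , r) ∈ (R ++ S) → fsize r ≤ M
  rhs≤M = ∈⇒≤sum-map (fsize ∘ proj₂)

  occ-nonDup : ∀ {l r} → (l , r) ∈ (R ++ S) → ∀ x → occ x (vars r) ≤ occ x (vars l)
  occ-nonDup {l} {r} l→r∈ x = subst₂ _≤_ (varCount≡occ x r) (varCount≡occ x l) (nonDup l r l→r∈ x)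

  -- V (k + 1) exceeds M copies of V k, so one symbol outweighs a lifted rhs
  V : ℕ → ℕ
  V zero = 0
  V (suc k) = suc (suc M * V k)

  V-mono : ∀ {a b} → a ≤ b → V a ≤ V b
  V-mono {zero} _ = z≤n
  V-mono {suc a} {suc b} (s≤s a≤b) = s≤s (*-monoʳ-≤ (suc M) (V-mono a≤b))

  -- symbols at height c or above weigh nothing
  W : ℕ → ℕ
  W h = V (c ∸ h)

  W-antitone : ∀ {a b} → a ≤ b → W b ≤ W a
  W-antitone a≤b = V-mono (∸-monoʳ-≤ c a≤b)

  W-c : W c ≡ 0
  W-c = cong V (n∸n≡0 c)

  W-step : ∀ h (r : Term F ar) → h < c → fsize r ≤ M → fsize r * W (suc h) < W h
  W-step h r h<c r≤M rewrite ∸-suc-split c h h<c = s≤s (*-monoˡ-≤ (V (c ∸ suc h)) (m≤n⇒m≤1+n r≤M))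

  open Weights W W-antitone

  RTHeight : TermL F ar → Term F ar → Set
  RTHeight l' r = Σ ℕ λ d →
    ((RTCond l' r × d ≡ c ⊓ rootH l') ⊎ (¬ RTCond l' r × d ≡ minℕ (c ∷ lmap suc (heights l'))))
    × fsize r * W d ≤ weight l'

  uniform-bound : (l' : TermL F ar) (r : Term F ar) → RTCond l' r → fsize r * W (c ⊓ rootH l') ≤ weight l'
  uniform-bound l' r (r≤l , uniform) with ⊓-sel c (rootH l')
  ... | inj₁ e rewrite e | W-c | *-zeroʳ (fsize r) = z≤n
  ... | inj₂ e rewrite e = begin
    fsize r * W (rootH l')        ≤⟨ *-monoˡ-≤ (W (rootH l')) r≤l ⟩
    fsize (base l') * W (rootH l') ≡⟨ sym (weight-lift (rootH l') (base l')) ⟩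
    weight (lift (rootH l') (base l')) ≡⟨ cong weight uniform ⟩
    weight l'                      ∎
    where open ≤-Reasoning

  raised-bound : (l' : TermL F ar) (r : Term F ar) → fsize r ≤ M → fsize r * W (minℕ (c ∷ lmap suc (heights l'))) ≤ weight l'
  raised-bound l' r r≤M with min-suc-cases c (heights l')
  ... | inj₁ e rewrite e | W-c | *-zeroʳ (fsize r) = z≤n
  ... | inj₂ (h , h∈l' , h<c , e) rewrite e = ≤-trans (<⇒≤ (W-step h r h<c r≤M)) (height⇒W≤weight l' h∈l')

  rtHeight : (l' : TermL F ar) (r : Term F ar) → fsize r ≤ M → RTHeight l' r
  rtHeight l' r r≤M with RTCond? l' r
  ... | yes cond = c ⊓ rootH l' , inj₁ (cond , refl) , uniform-bound l' r cond
  ... | no ¬cond = minℕ (c ∷ lmap suc (heights l')) , inj₂ (¬cond , refl) , raised-bound l' r r≤M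

  Decreasing : TermL F ar → TermL F ar → Set
  Decreasing s' t' = All (_≤ c) (heights t') → weight t' < weight s'

  NonIncreasing : TermL F ar → TermL F ar → Set
  NonIncreasing s' t' = weight t' ≤ weight s'

  -- a root R-step is simulated by a match(R)-step; the rhs is not a variable
  -- (R is non-collapsing), so the new root has height d = 1 + min heights(lhs)
  rootR : Simulates (RootStep ⟦ R ⟧) (RootStepL (matchRules R)) Decreasing
  rootR (l , var x , σ , l→r∈R , refl , refl) p = ⊥-elim (nonColl l (var x) l→r∈R (x , refl))
  rootR {s' = s'} (l , r@(fun g rs) , σ , l→r∈R , refl , refl) p =
    lift d r ⟨ σ' ⟩ , result-◂ d r (proj₂ (All.lookup isR l→r∈R)) ,
    simulatedStep d r (r , subst (λ l₀ → (l₀ , r) ∈ R) (sym lhs-base) l→r∈R , refl) , decreasing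
    where
    m : AnnotMatch l σ s'
    m = annotMatch l σ p
    open AnnotMatch m
    open JoinedSubst m
    h : ℕ
    h = minℕ (heights lhs)
    d : ℕ
    d = suc h
    -- the height bound at the root gives h < c
    decreasing : Decreasing s' (lift d r ⟨ σ' ⟩)
    decreasing (h<c ∷ _) = begin-strict
      weight (lift d r ⟨ σ' ⟩)          ≤⟨ result-weight d r (occ-nonDup (∈-++⁺ˡ l→r∈R)) ⟩
      fsize r * W d + bindingWeight θ    <⟨ +-monoˡ-< (bindingWeight θ) (<-≤-trans (W-step h r h<c (rhs≤M (∈-++⁺ˡ l→r∈R))) W-h≤lhs) ⟩
      weight lhs + bindingWeight θ       ≡⟨ sym weight-split ⟩
      weight s'                          ∎
      where
      open ≤-Reasoning
      W-h≤lhs : W h ≤ weight lhs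
      W-h≤lhs = W-minHeight≤weight lhs (λ isVar → proj₁ (All.lookup isR l→r∈R) (subst IsVar lhs-base isVar))

  rootS : Simulates (RootStep ⟦ S ⟧) (RootStepL (MATCHRT c S)) NonIncreasing
  rootS {s' = s'} (l , r , σ , l→r∈S , refl , refl) p = simulate (rtHeight lhs r (rhs≤M (∈-++⁺ʳ R l→r∈S)))
    where
    m : AnnotMatch l σ s'
    m = annotMatch l σ p
    open AnnotMatch m
    open JoinedSubst m
    simulate : RTHeight lhs r → Σ (TermL F ar) λ t' → t' ◂ r ⟨ σ ⟩ × RootStepL (MATCHRT c S) s' t' × NonIncreasing s' t'
    simulate (d , label , r≤lhs) =
      lift d r ⟨ σ' ⟩ , result-◂ d r (proj₂ (All.lookup isS l→r∈S)) ,
      simulatedStep d r (r , subst (λ l₀ → (l₀ , r) ∈ S) (sym lhs-base) l→r∈S , d , refl , label) , (begin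
        weight (lift d r ⟨ σ' ⟩)        ≤⟨ result-weight d r (occ-nonDup (∈-++⁺ʳ R l→r∈S)) ⟩
        fsize r * W d + bindingWeight θ  ≤⟨ +-monoˡ-≤ (bindingWeight θ) r≤lhs ⟩
        weight lhs + bindingWeight θ     ≡⟨ sym weight-split ⟩
        weight s'                        ∎)
      where open ≤-Reasoning

  decreasing-closed : ContextClosed Decreasing
  decreasing-closed f a ss' i dec (_ ∷ bounds) =
    +-monoʳ-< (W a) (update-weights< ss' i (dec (update-heights ss' i bounds)))

  nonIncreasing-closed : ContextClosed NonIncreasing
  nonIncreasing-closed f a ss' i le = +-monoʳ-≤ (W a) (update-weights ss' i le)

  stepR : Simulates (Step ⟦ R ⟧) (StepL (matchRules R)) Decreasing
  stepR = simulateInContext Decreasing decreasing-closed rootR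

  stepS : Simulates (Step ⟦ S ⟧) (StepL (MATCHRT c S)) NonIncreasing
  stepS = simulateInContext NonIncreasing nonIncreasing-closed rootS

  simulateS* : ∀ {s a s'} → Star (Step ⟦ S ⟧) s a → s' ◂ s → Ground s
    → Σ (TermL F ar) λ a' → a' ◂ a × Star (StepL (MATCHRT c S)) s' a' × weight a' ≤ weight s' × Ground a
  simulateS* {s' = s'} ε p g = s' , p , ε , ≤-refl , g
  simulateS* (st ◅ sts) p g with stepS st p
  ... | t' , t'◂t , st' , le with simulateS* sts t'◂t (step-ground isS st g)
  ... | a' , a'◂a , sts' , le' , ga = a' , a'◂a , st' ◅ sts' , ≤-trans le' le , ga

  -- s' is reachable from lift₀(L) by ⇝_{matchRT(R/S,c)}, so its ground
  -- successors have heights at most c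
  Reachable : TermL F ar → Set
  Reachable s' = ∃ λ u → Lift0 L u × Star (MatchRTStep c R S) u s'

  Tracks : Term F ar → TermL F ar → Set
  Tracks s s' = s' ◂ s × Ground s × Reachable s'

  relStep-simulated : ∀ {s v s'} → RelStep R S s v → Tracks s s' → Σ (TermL F ar) λ v' → Tracks v v' × weight v' < weight s'
  relStep-simulated (a , b , st₁ , stR , st₂) (p , g , u , u∈ , reach) with simulateS* st₁ p g
  ... | a' , a'◂a , st₁' , le₁ , ga with stepR stR a'◂a
  ... | b' , b'◂b , stR' , decreasing with step-ground isR stR ga
  ... | gb with simulateS* st₂ b'◂b gb
  ... | v' , v'◂v , st₂' , le₂ , gv =
    v' , (v'◂v , gv , u , u∈ , reach ◅◅ ((a' , b' , st₁' , stR' , st₂') ◅ ε)) ,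
    ≤-<-trans le₂ (<-≤-trans (decreasing b'-bounded) le₁)
    where
    b'-bounded : All (_≤ c) (heights b')
    b'-bounded = bounded b' (trans (◂-vars b'◂b) gb , u , u∈ , reach ◅◅ ((a' , b' , st₁' , stR' , ε) ◅ ε))

  derivation≤weight : ∀ {m s u s'} → Iter (RelStep R S) m s u → Tracks s s' → m ≤ weight s'
  derivation≤weight done _ = z≤n
  derivation≤weight (step st sts) tracks with relStep-simulated st tracks
  ... | v' , tracks' , lt = ≤-trans (s≤s (derivation≤weight sts tracks')) lt

  acc-by-weight : ∀ k s s' → Tracks s s' → weight s' < k → Acc (flip (RelStep R S)) s
  acc-by-weight (suc k) s s' tracks lt = acc next
    where
    next : ∀ {v} → RelStep R S s v → Acc (flip (RelStep R S)) v
    next {v} st with relStep-simulated st tracks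
    ... | v' , tracks' , lt' = acc-by-weight k v v' tracks' (<-≤-trans lt' (s≤s⁻¹ lt))

  tracks-lift₀ : {t : Term F ar} → L t → Tracks t (lift 0 t)
  tracks-lift₀ {t} t∈L = lift-◂ 0 t , L-ground t t∈L , lift 0 t , (t , t∈L , refl) , ε

  weight-lift₀ : (t : Term F ar) → weight (lift 0 t) ≤ size t * V c
  weight-lift₀ t = subst (_≤ size t * V c) (sym (weight-lift 0 t)) (*-monoˡ-≤ (V c) (fsize≤size t))

  terminating : TerminatingOn (RelStep R S) L
  terminating t t∈L = acc-by-weight (suc (weight (lift 0 t))) t (lift 0 t) (tracks-lift₀ t∈L) ≤-refl

  derivation-bound : ∀ {t : Term F ar} {m u} → L t → Iter (RelStep R S) m t u → m ≤ size t * V c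
  derivation-bound {t} t∈L derivation = ≤-trans (derivation≤weight derivation (tracks-lift₀ t∈L)) (weight-lift₀ t)

theorem5p12 : {F : Set} {ar : F → ℕ} (R S : List (Rule F ar)) (L : Term F ar → Set)
    → IsTRS R → IsTRS S
    → NonDuplicating (R ++ S) → NonCollapsing R
    → (∀ t → L t → Ground t)
    → MatchRaiseRTBounded R S L
    → TerminatingOn (RelStep R S) L × LinearCp (RelStep R S) L
theorem5p12 R S L isR isS nonDup nonColl L-ground (c , bounded) =
  terminating , (V c , 0 , λ n _ t t∈L |t|≤n m u derivation → begin
    m             ≤⟨ derivation-bound t∈L derivation ⟩
    size t * V c  ≤⟨ *-monoˡ-≤ (V c) |t|≤n ⟩
    n * V c       ≡⟨ *-comm n (V c) ⟩
    V c * n       ∎)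
  where
  open Simulation R S L isR isS nonDup nonColl L-ground c bounded
  open ≤-Reasoning
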